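{- Let $D$ be a locally in-semicomplete digraph or a locally out-semicomplete digraph. If the underlying graph $G_D$ is a cycle on at least $4$ vertices, then $D$ is a directed cycle. If the complement $\overline{G}_D$ of $G_D$ is a cycle on at least $5$ vertices, then $D\cong \overrightarrow{C}_{2n+1}(2,-3,4,-5,\dots, (-1)^nn)$ for some $n\ge 2$.
   Context: Digraphs are finite, without loops or parallel arcs; both arcs $uv$ and $vu$ may be present. The underlying graph $G_D$ has vertex set $V(D)$, with $\{u,v\}$ an edge iff $uv\in A(D)$ or $vu\in A(D)$. A digraph is semicomplete if every two distinct vertices are joined by at least one arc. $D$ is locally in-semicomplete (resp. locally out-semicomplete) if for every vertex $v$ the in-neighbourhood $N^-(v)$ (resp. out-neighbourhood $N^+(v)$) induces a semicomplete subdigraph. For nonempty $J\subseteq\mathbb{Z}_m\setminus\{0\}$, the circulant digraph $\overrightarrow{C}_m(J)$ has vertex set $\mathbb{Z}_m$ and arcs $(i,j)$ with $j-i\in J$; $\overrightarrow{C}_{2n+1}(2,-3,4,\dots,(-1)^nn)$ means $J=\{(-1)^k k: 2\le k\le n\}$. -}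

module Defs where

open import Data.Nat using (ℕ; zero; suc; _+_; _*_; _≤_)
open import Data.Nat.DivMod using (_%_)
open import Data.Fin using (Fin; toℕ)
open import Data.Bool using (Bool; true; false)
open import Data.Product using (Σ; _×_; ∃-syntax)
open import Data.Sum using (_⊎_)
open import Data.Empty using (⊥)
open import Relation.Nullary using (¬_)
open import Relation.Binary.PropositionalEquality using (_≡_; _≢_)
open import Data.Fin.Permutation using (Permutation; Permutation′; _⟨$⟩ʳ_)

-- A (finite) digraph on vertex set Fin n: a Boolean arc relation without loops.
-- (Boolean-valued, hence no parallel arcs; both uv and vu may be arcs.)
record Digraph (n : ℕ) : Set where
  field
    arc      : Fin n → Fin n → Bool
    loopless : ∀ v → arc v v ≡ false
open Digraph public

Arc : ∀ {n} → Digraph n → Fin n → Fin n → Set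
Arc D u v = arc D u v ≡ true

AdjU : ∀ {n} → Digraph n → Fin n → Fin n → Set
AdjU D u v = Arc D u v ⊎ Arc D v u

AdjCompl : ∀ {n} → Digraph n → Fin n → Fin n → Set
AdjCompl D u v = u ≢ v × ¬ AdjU D u v

LocallyInSemicomplete : ∀ {n} → Digraph n → Set
LocallyInSemicomplete D = ∀ v x y → Arc D x v → Arc D y v → x ≢ y → AdjU D x y

LocallyOutSemicomplete : ∀ {n} → Digraph n → Set
LocallyOutSemicomplete D = ∀ v x y → Arc D v x → Arc D v y → x ≢ y → AdjU D x y

CycleAdj : (n : ℕ) → Fin n → Fin n → Set
CycleAdj zero    i j = ⊥
CycleAdj (suc m) i j = toℕ j ≡ suc (toℕ i) % suc m ⊎ toℕ i ≡ suc (toℕ j) % suc m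

DCycleArc : (n : ℕ) → Fin n → Fin n → Set
DCycleArc zero    i j = ⊥
DCycleArc (suc m) i j = toℕ j ≡ suc (toℕ i) % suc m

IsCycleGraph : (n : ℕ) → (Fin n → Fin n → Set) → Set
IsCycleGraph n G = Σ (Permutation′ n) λ σ → (∀ u v → (G u v → CycleAdj n (σ ⟨$⟩ʳ u) (σ ⟨$⟩ʳ v))
                                 × (CycleAdj n (σ ⟨$⟩ʳ u) (σ ⟨$⟩ʳ v) → G u v))

IsDirectedCycle : ∀ {n} → Digraph n → Set
IsDirectedCycle {n} D = Σ (Permutation′ n) λ σ →
  ∀ u v → (Arc D u v → DCycleArc n (σ ⟨$⟩ʳ u) (σ ⟨$⟩ʳ v))
        × (DCycleArc n (σ ⟨$⟩ʳ u) (σ ⟨$⟩ʳ v) → Arc D u v)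

-- arcs of the circulant digraph C_{2k+1}(2,-3,4,...,(-1)^k k) on Fin (2k+1):
-- (i,j) is an arc iff j - i ≡ (-1)^m m (mod 2k+1) for some 2 ≤ m ≤ k,
-- i.e. j ≡ i + m for even m, and i ≡ j + m for odd m.
AltCirculantArc : (k : ℕ) → Fin (suc (2 * k)) → Fin (suc (2 * k)) → Set
AltCirculantArc k i j = ∃[ m ] (2 ≤ m × m ≤ k ×
  ((m % 2 ≡ 0 × toℕ j ≡ (toℕ i + m) % suc (2 * k))
   ⊎ (m % 2 ≡ 1 × toℕ i ≡ (toℕ j + m) % suc (2 * k))))

IsoAltCirculant : ∀ {n} → Digraph n → ℕ → Set
IsoAltCirculant {n} D k = Σ (Permutation n (suc (2 * k))) λ σ →
  ∀ u v → (Arc D u v → AltCirculantArc k (σ ⟨$⟩ʳ u) (σ ⟨$⟩ʳ v))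
        × (AltCirculantArc k (σ ⟨$⟩ʳ u) (σ ⟨$⟩ʳ v) → Arc D u v)

-- Transport D along the given isomorphism onto the cycle, getting a
-- relation T on the positions 0 … N - 1 of C_N.  Reversing all arcs turns the
-- out-semicomplete case into the in-semicomplete one, and both target digraphs
-- are invariant under "reverse every arc and reflect i ↦ N - 1 - i", so only
-- locally in-semicomplete T need to be treated (in-semicomplete-form); the
-- targets being defined up to reflection, we show that T or its reflection is
-- the target (Dichotomy).  The core argument, for T locally in-semicomplete:
--  * G_T = C_N: two in-neighbours of a vertex are adjacent, so an arc v → v+1
--    forces v+1 → v+2, and going round the cycle T is directed (DirectedCycle);
--  * G_T = complement of C_N: consecutive vertices are non-adjacent in G_T,
--    hence have no common out-neighbour.  One arc of length two forces all
--    of them, then offsets alternate — even ones forwards, odd ones backwards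
--    (AlternatingOrientation).  This forces N to be odd, and for N = 2k + 1 the
--    even offsets are exactly the arcs of C_{2k+1}(2, -3, 4, …) (AltCirculant).
module Submission where

open import Data.Nat using (ℕ; zero; suc; _+_; _*_; _∸_; _≤_; _<_; _≤?_; z≤n; s≤s)
open import Data.Nat.Properties
open import Data.Nat.DivMod using (_%_; m%n%n≡m%n; [m+n]%n≡m%n; [m+kn]%n≡m%n; %-distribˡ-+; m%n<n; m<n⇒m%n≡m)
open import Data.Nat.Tactic.RingSolver using (solve-∀)
open import Data.Fin using (Fin; toℕ; fromℕ<; opposite)
open import Data.Fin.Properties using (toℕ-fromℕ<; toℕ-injective; toℕ<n; opposite-prop; opposite-involutive)
open import Data.Bool using (true)
open import Data.Bool.Properties using () renaming (_≟_ to _≟ᵇ_)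
open import Data.Fin.Permutation using (Permutation; Permutation′; _⟨$⟩ʳ_; _⟨$⟩ˡ_; inverseˡ; inverseʳ; reverse; _∘ₚ_)
open import Function.Base using (flip; _∘_)
open import Data.Product using (Σ; _×_; _,_; proj₁; proj₂)
open import Data.Sum using (_⊎_; inj₁; inj₂; swap; map; reduce) renaming ([_,_] to either)
open import Data.Empty using (⊥; ⊥-elim)
open import Relation.Nullary using (¬_; Dec; yes; no; _⊎-dec_)
open import Relation.Binary.Core using (_⇒_; _⇔_)
open import Relation.Binary.Bundles using (Setoid)
open import Relation.Binary.PropositionalEquality
  using (_≡_; _≢_; refl; sym; trans; cong; subst; subst₂; module ≡-Reasoning)
import Relation.Binary.Reasoning.Setoid as SetoidReasoning
open import Defs

Rel : ℕ → Set₁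
Rel n = Fin n → Fin n → Set

Sym : ∀ {n} → Rel n → Rel n
Sym T x y = T x y ⊎ T y x

Reflect : ∀ {n} → Rel n → Rel n
Reflect T x y = T (opposite x) (opposite y)

Relabel : ∀ {n n′} → Permutation n n′ → Rel n → Rel n′
Relabel σ A x y = A (σ ⟨$⟩ˡ x) (σ ⟨$⟩ˡ y)

Carries : ∀ {n n′} → Permutation n n′ → Rel n → Rel n′ → Set
Carries σ A C = ∀ u v → (A u v → C (σ ⟨$⟩ʳ u) (σ ⟨$⟩ʳ v)) × (C (σ ⟨$⟩ʳ u) (σ ⟨$⟩ʳ v) → A u v)

InLocal : ∀ {n} → Rel n → Set
InLocal T = ∀ {x y w} → T x w → T y w → x ≢ y → Sym T x y

record LocallyInOver {n} (G T : Rel n) : Set where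
  field
    underlying : Sym T ⇔ G
    in-local   : InLocal T

Dichotomy : ∀ {n} → Rel n → Rel n → Set
Dichotomy P T = (T ⇔ P) ⊎ (Reflect T ⇔ P)

ReversalInvariant : ∀ {n} → Rel n → Set
ReversalInvariant P = P ⇒ flip (Reflect P)

⇔-trans : ∀ {n} {A B C : Rel n} → A ⇔ B → B ⇔ C → A ⇔ C
⇔-trans (ab , ba) (bc , cb) = bc ∘ ab , ba ∘ cb

⇔-sym : ∀ {n} {A B : Rel n} → A ⇔ B → B ⇔ A
⇔-sym (ab , ba) = ba , ab

inverse-injective : ∀ {n n′} (σ : Permutation n n′) {x y} → σ ⟨$⟩ˡ x ≡ σ ⟨$⟩ˡ y → x ≡ y
inverse-injective σ {x} {y} e = trans (sym (inverseʳ σ)) (trans (cong (σ ⟨$⟩ʳ_) e) (inverseʳ σ))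

opposite-injective : ∀ {n} {x y : Fin n} → opposite x ≡ opposite y → x ≡ y
opposite-injective {x = x} {y} e =
  trans (sym (opposite-involutive x)) (trans (cong opposite e) (opposite-involutive y))

carries⇒relabel : ∀ {n n′} (σ : Permutation n n′) {A C} → Carries σ A C → Relabel σ A ⇔ C
carries⇒relabel σ {A} {C} iso =
    (λ a → subst₂ C (inverseʳ σ) (inverseʳ σ) (proj₁ (iso _ _) a))
  , (λ c → proj₂ (iso _ _) (subst₂ C (sym (inverseʳ σ)) (sym (inverseʳ σ)) c))

relabel⇒carries : ∀ {n n′} (σ : Permutation n n′) {A C} → Relabel σ A ⇔ C → Carries σ A C
relabel⇒carries σ {A} (to , from) u v =
    (λ a → to (subst₂ A (sym (inverseˡ σ)) (sym (inverseˡ σ)) a))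
  , (λ c → subst₂ A (inverseˡ σ) (inverseˡ σ) (from c))

carries-⇔ : ∀ {n n′} {π : Permutation n n′} {A P Q} → Carries π A P → P ⇔ Q → Carries π A Q
carries-⇔ iso (to , from) u v = to ∘ proj₁ (iso u v) , proj₂ (iso u v) ∘ from

reflect-involutive : ∀ {n} {T : Rel n} → Reflect (Reflect T) ⇔ T
reflect-involutive {T = T} =
    (λ t → subst₂ T (opposite-involutive _) (opposite-involutive _) t)
  , (λ t → subst₂ T (sym (opposite-involutive _)) (sym (opposite-involutive _)) t)

dichotomy-carries : ∀ {n} (σ : Permutation′ n) {A P : Rel n} →
  Dichotomy P (Relabel σ A) → Σ (Permutation′ n) λ π → Carries π A P
dichotomy-carries σ (inj₁ e) = σ , relabel⇒carries σ e
dichotomy-carries σ (inj₂ e) = σ ∘ₚ reverse , relabel⇒carries (σ ∘ₚ reverse) e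

flip⇒reflect : ∀ {n} {T P : Rel n} → ReversalInvariant P → flip T ⇔ P → Reflect T ⇔ P
flip⇒reflect {P = P} inv (to , from) =
    (λ t → proj₁ (reflect-involutive {T = P}) (inv (to t)))
  , (λ p → from (inv p))

dichotomy-flip : ∀ {n} {T P : Rel n} → ReversalInvariant P → Dichotomy P (flip T) → Dichotomy P T
dichotomy-flip inv (inj₁ e) = inj₂ (flip⇒reflect inv e)
dichotomy-flip {T = T} inv (inj₂ e) =
  inj₁ (⇔-trans (⇔-sym (reflect-involutive {T = T})) (flip⇒reflect inv e))

reflect-locallyIn : ∀ {n} {G T : Rel n} → G ⇔ Reflect G → LocallyInOver G T → LocallyInOver G (Reflect T)
reflect-locallyIn (G⇒ , ⇒G) S = record
  { underlying = ⇒G ∘ proj₁ underlying , proj₂ underlying ∘ G⇒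
  ; in-local   = λ t₁ t₂ x≢y → in-local t₁ t₂ (x≢y ∘ opposite-injective) }
  where open LocallyInOver S

-- It suffices to treat locally in-semicomplete relations: reversing every
-- arc of a locally out-semicomplete digraph makes it locally in-semicomplete,
-- and the answer for the reversed relation transfers back when P is reversal invariant.
in-semicomplete-form : ∀ {n} (D : Digraph n) (σ : Permutation′ n) {G : Rel n} →
  LocallyInSemicomplete D ⊎ LocallyOutSemicomplete D → Sym (Relabel σ (Arc D)) ⇔ G →
  Σ (Rel n) λ T → LocallyInOver G T ×
    (∀ {P} → ReversalInvariant P → Dichotomy P T → Dichotomy P (Relabel σ (Arc D)))
in-semicomplete-form D σ {G} (inj₁ L) graph = Relabel σ (Arc D) , S , λ _ d → d
  where
  S : LocallyInOver G (Relabel σ (Arc D))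
  S = record
    { underlying = graph
    ; in-local   = λ t₁ t₂ x≢y → L _ _ _ t₁ t₂ (x≢y ∘ inverse-injective σ) }
in-semicomplete-form D σ {G} (inj₂ L) graph = flip (Relabel σ (Arc D)) , S , dichotomy-flip
  where
  S : LocallyInOver G (flip (Relabel σ (Arc D)))
  S = record
    { underlying = proj₁ graph ∘ swap , swap ∘ proj₂ graph
    ; in-local   = λ t₁ t₂ x≢y → swap (L _ _ _ t₁ t₂ (x≢y ∘ inverse-injective σ)) }

-- Parity.  Doubling is defined by recursion, so that twice (suc j) reduces to 2 + twice j.
twice : ℕ → ℕ
twice zero    = zero
twice (suc j) = suc (suc (twice j))

twice≡2* : ∀ j → twice j ≡ 2 * j
twice≡2* zero    = refl
twice≡2* (suc j) = trans (cong (suc ∘ suc) (twice≡2* j)) (sym (*-suc 2 j))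

even-or-odd : ∀ d → Σ ℕ λ j → d ≡ twice j ⊎ d ≡ suc (twice j)
even-or-odd zero = zero , inj₁ refl
even-or-odd (suc d) with even-or-odd d
... | j , inj₁ refl = j , inj₂ refl
... | j , inj₂ refl = suc j , inj₁ refl

even-gap : ∀ j k → suc (twice j) ≤ twice k → twice (suc j) ≤ twice k
even-gap j       zero    ()
even-gap zero    (suc k) _                 = s≤s (s≤s z≤n)
even-gap (suc j) (suc k) (s≤s (s≤s le))    = s≤s (s≤s (even-gap j k le))

twice≡+ : ∀ j → twice j ≡ j + j
twice≡+ zero    = refl
twice≡+ (suc j) = cong suc (trans (cong suc (twice≡+ j)) (sym (+-suc j j)))

≤-twice : ∀ i → i ≤ twice i
≤-twice i = ≤-trans (m≤m+n i i) (≤-reflexive (sym (twice≡+ i)))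

twice-+ : ∀ i j → twice (i + j) ≡ twice i + twice j
twice-+ zero    j = refl
twice-+ (suc i) j = cong (suc ∘ suc) (twice-+ i j)

twice-cancel-≤ : ∀ {i j} → twice i ≤ twice j → i ≤ j
twice-cancel-≤ {zero}              _                 = z≤n
twice-cancel-≤ {suc i} {suc j} (s≤s (s≤s le)) = s≤s (twice-cancel-≤ le)

twice-%2 : ∀ j → twice j % 2 ≡ 0
twice-%2 zero    = refl
twice-%2 (suc j) = trans (cong (_% 2) (+-comm 2 (twice j))) (trans ([m+n]%n≡m%n (twice j) 2) (twice-%2 j))

odd-%2 : ∀ j → suc (twice j) % 2 ≡ 1
odd-%2 zero    = refl
odd-%2 (suc j) = trans (cong (_% 2) (+-comm 2 (suc (twice j)))) (trans ([m+n]%n≡m%n (suc (twice j)) 2) (odd-%2 j))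

%2≡0⇒even : ∀ e → e % 2 ≡ 0 → Σ ℕ λ j → e ≡ twice j
%2≡0⇒even e e%2≡0 with even-or-odd e
... | j , inj₁ e≡ = j , e≡
... | j , inj₂ refl with trans (sym (odd-%2 j)) e%2≡0
...   | ()

%2≡1⇒odd : ∀ e → e % 2 ≡ 1 → Σ ℕ λ i → e ≡ suc (twice i)
%2≡1⇒odd e e%2≡1 with even-or-odd e
... | i , inj₂ e≡ = i , e≡
... | i , inj₁ refl with trans (sym (twice-%2 i)) e%2≡1
...   | ()

-- Arithmetic modulo N = m + 1, the number of vertices of the cycle.
module Modular (m : ℕ) where

  N : ℕ
  N = suc m

  -- Congruence modulo N, wrapped in a record so that Agda can infer a and b.
  infix 4 _≋_
  record _≋_ (a b : ℕ) : Set where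
    constructor mk≋
    field residue : a % N ≡ b % N
  open _≋_ public

  ≋-setoid : Setoid _ _
  ≋-setoid = record
    { Carrier = ℕ
    ; _≈_ = _≋_
    ; isEquivalence = record
      { refl = mk≋ refl
      ; sym = λ e → mk≋ (sym (residue e))
      ; trans = λ e f → mk≋ (trans (residue e) (residue f)) } }

  open Setoid ≋-setoid public using () renaming (refl to ≋-refl; sym to ≋-sym; trans to ≋-trans)
  module ≋-Reasoning = SetoidReasoning ≋-setoid

  ≡⇒≋ : ∀ {a b} → a ≡ b → a ≋ b
  ≡⇒≋ refl = ≋-refl

  mod-≋ : ∀ a → a % N ≋ a
  mod-≋ a = mk≋ (m%n%n≡m%n a N)

  +N-≋ : ∀ a → a + N ≋ a
  +N-≋ a = mk≋ ([m+n]%n≡m%n a N)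

  +kN-≋ : ∀ a k → a + k * N ≋ a
  +kN-≋ a k = mk≋ ([m+kn]%n≡m%n a k N)

  -- adding b full turns (b + b * m = b * N) changes nothing
  wind : ∀ a b → a + b * m + b ≋ a
  wind a b = ≋-trans (≡⇒≋ (rearrange a b m)) (+kN-≋ a b)
    where
    rearrange : ∀ a b m → a + b * m + b ≡ a + b * suc m
    rearrange = solve-∀

  ≋-+ˡ : ∀ c {a b} → a ≋ b → c + a ≋ c + b
  ≋-+ˡ c {a} {b} (mk≋ e) = mk≋ (begin
      (c + a) % N              ≡⟨ %-distribˡ-+ c a N ⟩
      (c % N + a % N) % N      ≡⟨ cong (λ r → (c % N + r) % N) e ⟩
      (c % N + b % N) % N      ≡⟨ %-distribˡ-+ c b N ⟨
      (c + b) % N              ∎)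
    where open ≡-Reasoning

  ≋-+ʳ : ∀ c {a b} → a ≋ b → a + c ≋ b + c
  ≋-+ʳ c {a} {b} e = begin
    a + c  ≡⟨ +-comm a c ⟩
    c + a  ≈⟨ ≋-+ˡ c e ⟩
    c + b  ≡⟨ +-comm c b ⟩
    b + c  ∎
    where open ≋-Reasoning

  -- m + 1 steps make a full turn, so m + a is the predecessor of a
  full-turn : ∀ a → suc (m + a) ≋ a
  full-turn a = ≋-trans (≡⇒≋ (+-comm N a)) (+N-≋ a)

  suc-cancel-≋ : ∀ {a b} → suc a ≋ suc b → a ≋ b
  suc-cancel-≋ {a} {b} e = begin
    a            ≈⟨ full-turn a ⟨
    suc (m + a)  ≡⟨ +-suc m a ⟨
    m + suc a    ≈⟨ ≋-+ˡ m e ⟩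
    m + suc b    ≡⟨ +-suc m b ⟩
    suc (m + b)  ≈⟨ full-turn b ⟩
    b            ∎
    where open ≋-Reasoning

  +-cancelˡ-≋ : ∀ c {a b} → c + a ≋ c + b → a ≋ b
  +-cancelˡ-≋ zero    e = e
  +-cancelˡ-≋ (suc c) e = +-cancelˡ-≋ c (suc-cancel-≋ e)

  <N-≋⇒≡ : ∀ {a b} → a < N → b < N → a ≋ b → a ≡ b
  <N-≋⇒≡ {a} {b} a<N b<N (mk≋ e) = begin
    a      ≡⟨ m<n⇒m%n≡m a<N ⟨
    a % N  ≡⟨ e ⟩
    b % N  ≡⟨ m<n⇒m%n≡m b<N ⟩
    b      ∎
    where open ≡-Reasoning

  shift-injective : ∀ {a b} v → a < N → b < N → a + v ≋ b + v → a ≡ b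
  shift-injective {a} {b} v a<N b<N e = <N-≋⇒≡ a<N b<N (+-cancelˡ-≋ v (begin
    v + a  ≡⟨ +-comm v a ⟩
    a + v  ≈⟨ e ⟩
    b + v  ≡⟨ +-comm b v ⟩
    v + b  ∎))
    where open ≋-Reasoning

  [_] : ℕ → Fin N
  [ a ] = fromℕ< (m%n<n a N)

  toℕ[] : ∀ a → toℕ [ a ] ≋ a
  toℕ[] a = ≋-trans (≡⇒≋ (toℕ-fromℕ< (m%n<n a N))) (mod-≋ a)

  toℕ-≋-injective : {x y : Fin N} → toℕ x ≋ toℕ y → x ≡ y
  toℕ-≋-injective {x} {y} e = toℕ-injective (<N-≋⇒≡ (toℕ<n x) (toℕ<n y) e)

  []-cong : ∀ {a b} → a ≋ b → [ a ] ≡ [ b ]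
  []-cong {a} {b} e = toℕ-≋-injective (≋-trans (toℕ[] a) (≋-trans e (≋-sym (toℕ[] b))))

  [toℕ] : (x : Fin N) → [ toℕ x ] ≡ x
  [toℕ] x = toℕ-≋-injective (toℕ[] (toℕ x))

-- Offsets between the vertices 0, …, m of the cycle C_N and their symmetries.
module CycleGeometry (m : ℕ) where
  open Modular m

  Step : ℕ → Fin N → Fin N → Set
  Step d x y = toℕ y ≋ d + toℕ x

  step-[] : ∀ {d a b} → b ≋ d + a → Step d [ a ] [ b ]
  step-[] {d} {a} {b} e = begin
    toℕ [ b ]      ≈⟨ toℕ[] b ⟩
    b              ≈⟨ e ⟩
    d + a          ≈⟨ ≋-+ˡ d (toℕ[] a) ⟨
    d + toℕ [ a ]  ∎
    where open ≋-Reasoning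

  step-trans : ∀ {d e x y z} → Step d x y → Step e y z → Step (e + d) x z
  step-trans {d} {e} {x} {y} {z} xy yz = begin
    toℕ z            ≈⟨ yz ⟩
    e + toℕ y        ≈⟨ ≋-+ˡ e xy ⟩
    e + (d + toℕ x)  ≡⟨ +-assoc e d (toℕ x) ⟨
    e + d + toℕ x    ∎
    where open ≋-Reasoning

  step-unique : ∀ {d e x y} → d < N → e < N → Step d x y → Step e x y → d ≡ e
  step-unique {x = x} d<N e<N p q = shift-injective (toℕ x) d<N e<N (≋-trans (≋-sym p) q)

  offset : (x y : Fin N) → Σ ℕ λ d → d < N × Step d x y
  offset x y = d , m%n<n (toℕ y + (N ∸ toℕ x)) N , ≋-sym d+x≋y
    where
    d : ℕ
    d = (toℕ y + (N ∸ toℕ x)) % N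
    open ≋-Reasoning
    d+x≋y : d + toℕ x ≋ toℕ y
    d+x≋y = begin
      d + toℕ x                      ≈⟨ ≋-+ʳ (toℕ x) (mod-≋ _) ⟩
      toℕ y + (N ∸ toℕ x) + toℕ x    ≡⟨ +-assoc (toℕ y) _ _ ⟩
      toℕ y + (N ∸ toℕ x + toℕ x)    ≡⟨ cong (toℕ y +_) (m∸n+n≡m (<⇒≤ (toℕ<n x))) ⟩
      toℕ y + N                      ≈⟨ +N-≋ (toℕ y) ⟩
      toℕ y                          ∎

  dcycle⇔step : DCycleArc N ⇔ Step 1
  dcycle⇔step = (λ {x} {y} e → mk≋ (trans (m<n⇒m%n≡m (toℕ<n y)) e))
              , (λ {x} {y} s → trans (sym (m<n⇒m%n≡m (toℕ<n y))) (residue s))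

  cycle⇔step : CycleAdj N ⇔ Sym (Step 1)
  cycle⇔step = map (proj₁ dcycle⇔step) (proj₁ dcycle⇔step)
             , map (proj₂ dcycle⇔step) (proj₂ dcycle⇔step)

  far-apart : ∀ {d x y} → 2 ≤ d → 2 + d ≤ N → Step d x y → x ≢ y × ¬ CycleAdj N x y
  far-apart {suc (suc d)} {x = x} (s≤s (s≤s _)) d+2≤N s = distinct , nonadjacent
    where
    d<N : suc (suc d) < N
    d<N = ≤-trans (n≤1+n _) d+2≤N
    distinct : x ≢ _
    distinct refl with step-unique d<N (s≤s z≤n) s ≋-refl
    ... | ()
    nonadjacent : ¬ CycleAdj N x _
    nonadjacent c with proj₁ cycle⇔step c
    ... | inj₁ s₁ with step-unique d<N (≤-trans (s≤s (s≤s z≤n)) d+2≤N) s s₁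
    ...   | ()
    nonadjacent c | inj₂ s₁ with step-unique {d = suc (suc (suc d))} d+2≤N (s≤s z≤n)
                                   (step-trans {d = suc (suc d)} s s₁) ≋-refl
    ... | ()

  opposite-sum : (x : Fin N) → toℕ (opposite x) + toℕ x ≡ m
  opposite-sum x = trans (cong (_+ toℕ x) (opposite-prop x)) (m∸n+n≡m (≤-pred (toℕ<n x)))

  step-reflect : ∀ {J x y} → Step J x y → Step J (opposite y) (opposite x)
  step-reflect {J} {x} {y} s = +-cancelˡ-≋ (toℕ y) (begin
    toℕ y + toℕ (opposite x)          ≈⟨ ≋-+ʳ _ s ⟩
    J + toℕ x + toℕ (opposite x)      ≡⟨ +-assoc J _ _ ⟩
    J + (toℕ x + toℕ (opposite x))    ≡⟨ cong (J +_) (trans (+-comm (toℕ x) _) (opposite-sum x)) ⟩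
    J + m                             ≡⟨ cong (J +_) (opposite-sum y) ⟨
    J + (toℕ (opposite y) + toℕ y)    ≡⟨ lemma J (toℕ (opposite y)) (toℕ y) ⟩
    toℕ y + (J + toℕ (opposite y))    ∎)
    where
    open ≋-Reasoning
    lemma : ∀ a b c → a + (b + c) ≡ c + (a + b)
    lemma = solve-∀

  step-reflect⁻¹ : ∀ {J x y} → Step J (opposite y) (opposite x) → Step J x y
  step-reflect⁻¹ {J} {x} {y} s =
    subst₂ (Step J) (opposite-involutive x) (opposite-involutive y) (step-reflect s)

  cycle-reflect : CycleAdj N ⇔ Reflect (CycleAdj N)
  cycle-reflect = (λ c → proj₂ cycle⇔step (reflect-steps (proj₁ cycle⇔step c)))
                , (λ c → proj₂ cycle⇔step (reflect-steps⁻¹ (proj₁ cycle⇔step c)))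
    where
    reflect-steps : ∀ {x y} → Sym (Step 1) x y → Sym (Step 1) (opposite x) (opposite y)
    reflect-steps (inj₁ s) = inj₂ (step-reflect s)
    reflect-steps (inj₂ s) = inj₁ (step-reflect s)
    reflect-steps⁻¹ : ∀ {x y} → Sym (Step 1) (opposite x) (opposite y) → Sym (Step 1) x y
    reflect-steps⁻¹ (inj₁ s) = inj₂ (step-reflect⁻¹ s)
    reflect-steps⁻¹ (inj₂ s) = inj₁ (step-reflect⁻¹ s)

  step-complement : ∀ {d e x y} → Step d x y → d + e ≡ N → Step e y x
  step-complement {d} {e} {x} {y} s d+e≡N = begin
    toℕ x            ≈⟨ +N-≋ (toℕ x) ⟨
    toℕ x + N        ≡⟨ cong (toℕ x +_) d+e≡N ⟨
    toℕ x + (d + e)  ≡⟨ rearrange (toℕ x) d e ⟩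
    e + (d + toℕ x)  ≈⟨ ≋-+ˡ e s ⟨
    e + toℕ y        ∎
    where
    open ≋-Reasoning
    rearrange : ∀ a d e → a + (d + e) ≡ e + (d + a)
    rearrange = solve-∀

  step→mod : ∀ {d x y} → Step d x y → toℕ y ≡ (toℕ x + d) % N
  step→mod {d} {x} {y} s =
    trans (sym (m<n⇒m%n≡m (toℕ<n y))) (trans (residue s) (cong (_% N) (+-comm d (toℕ x))))

  mod→step : ∀ {d x y} → toℕ y ≡ (toℕ x + d) % N → Step d x y
  mod→step {d} {x} {y} e =
    mk≋ (trans (m<n⇒m%n≡m (toℕ<n y)) (trans e (cong (_% N) (+-comm (toℕ x) d))))

  EvenStep : Rel N
  EvenStep x y = Σ ℕ λ j → 1 ≤ j × 3 + twice j ≤ N × Step (twice j) x y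

  dcycle-reversal : ReversalInvariant (DCycleArc N)
  dcycle-reversal = proj₂ dcycle⇔step ∘ step-reflect ∘ proj₁ dcycle⇔step

  even-step-reversal : ReversalInvariant EvenStep
  even-step-reversal (j , 1≤j , bound , s) = j , 1≤j , bound , step-reflect s

  NonAdj : Rel N
  NonAdj x y = x ≢ y × ¬ CycleAdj N x y

  nonadj-reflect : NonAdj ⇔ Reflect NonAdj
  nonadj-reflect = (λ (x≢y , nc) → x≢y ∘ opposite-injective , nc ∘ proj₂ cycle-reflect)
                 , (λ (x≢y , nc) → x≢y ∘ cong opposite , nc ∘ proj₁ cycle-reflect)

  step-distinct : 1 ≤ m → ∀ {x y} → Step 1 x y → x ≢ y
  step-distinct 1≤m s refl with step-unique (s≤s 1≤m) (s≤s z≤n) s ≋-refl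
  ... | ()

  step-last : ∀ {x y} → Step m x y → Step 1 y x
  step-last {x} {y} s = begin
    toℕ x              ≈⟨ full-turn (toℕ x) ⟨
    suc (m + toℕ x)    ≈⟨ ≋-+ˡ 1 s ⟨
    1 + toℕ y          ∎
    where open ≋-Reasoning

  far-offset : ∀ {x y} → NonAdj x y → Σ ℕ λ d → 2 ≤ d × 2 + d ≤ N × Step d x y
  far-offset {x} {y} (x≢y , nc) with offset x y
  ... | zero , _ , s = ⊥-elim (x≢y (sym (toℕ-≋-injective s)))
  ... | suc zero , _ , s = ⊥-elim (nc (proj₂ cycle⇔step (inj₁ s)))
  ... | suc (suc d) , d<N , s with 2 + suc (suc d) ≤? N
  ...   | yes d+2≤N = suc (suc d) , s≤s (s≤s z≤n) , d+2≤N , s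
  ...   | no d+2≰N = ⊥-elim (nc (proj₂ cycle⇔step (inj₂ (step-last (subst (λ e → Step e x y) d≡m s)))))
    where
    d≡m : suc (suc d) ≡ m
    d≡m = suc-injective (≤-antisym d<N (≮⇒≥ d+2≰N))

module Positions (m : ℕ) (T : Rel (suc m)) where
  open Modular m

  R : ℕ → ℕ → Set
  R a b = T [ a ] [ b ]

  R-resp : ∀ {a b} a′ b′ → a ≋ a′ → b ≋ b′ → R a b → R a′ b′
  R-resp _ _ e f = subst₂ T ([]-cong e) ([]-cong f)

  toR : ∀ {x y} → T x y → R (toℕ x) (toℕ y)
  toR {x} {y} = subst₂ T (sym ([toℕ] x)) (sym ([toℕ] y))

  fromR : ∀ {x y} → R (toℕ x) (toℕ y) → T x y
  fromR {x} {y} = subst₂ T ([toℕ] x) ([toℕ] y)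

module DirectedCycle (m : ℕ) (3≤m : 3 ≤ m) {T : Rel (suc m)} (S : LocallyInOver (CycleAdj (suc m)) T) where
  open Modular m
  open CycleGeometry m
  open Positions m T
  open LocallyInOver S

  -- v and v + 2 are distinct and non-adjacent, so they have no common out-neighbour
  no-common-head : ∀ v w → R v w → R (2 + v) w → ⊥
  no-common-head v w r₁ r₂ = nonadjacent (proj₁ underlying (in-local r₁ r₂ distinct))
    where
    apart : [ v ] ≢ [ 2 + v ] × ¬ CycleAdj N [ v ] [ 2 + v ]
    apart = far-apart ≤-refl (s≤s 3≤m) (step-[] {2} {v} ≋-refl)
    distinct : [ v ] ≢ [ 2 + v ]
    distinct = proj₁ apart
    nonadjacent : ¬ CycleAdj N [ v ] [ 2 + v ]
    nonadjacent = proj₂ apart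

  oriented : ∀ v → R v (suc v) ⊎ R (suc v) v
  oriented v = proj₂ underlying (proj₂ cycle⇔step (inj₁ (step-[] {1} {v} ≋-refl)))

  forward-step : ∀ v → R v (suc v) → R (suc v) (2 + v)
  forward-step v r with oriented (suc v)
  ... | inj₁ r′ = r′
  ... | inj₂ r′ = ⊥-elim (no-common-head v (suc v) r r′)

  forward-from : ∀ t {v} → R v (suc v) → R (t + v) (suc (t + v))
  forward-from zero    r = r
  forward-from (suc t) {v} r = forward-step (t + v) (forward-from t r)

  all-forward : ∀ {v₀} → R v₀ (suc v₀) → ∀ v → R v (suc v)
  all-forward {v₀} r v = R-resp v (suc v) (wind v v₀) (≋-+ˡ 1 (wind v v₀)) (forward-from (v + v₀ * m) r)

  directed-cycle : ∀ {x₀ y₀} → Step 1 x₀ y₀ → T x₀ y₀ → T ⇔ Step 1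
  directed-cycle {x₀} {y₀} s₀ t₀ = to , from
    where
    forward : ∀ v → R v (suc v)
    forward = all-forward (R-resp (toℕ x₀) (suc (toℕ x₀)) ≋-refl s₀ (toR t₀))
    from : ∀ {x y} → Step 1 x y → T x y
    from {x} {y} s = fromR (R-resp (toℕ x) (toℕ y) ≋-refl (≋-sym s) (forward (toℕ x)))
    -- a backward arc y + 1 → y would share its head with the forward arc y - 1 → y
    to : ∀ {x y} → T x y → Step 1 x y
    to {x} {y} t with proj₁ cycle⇔step (proj₁ underlying (inj₁ t))
    ... | inj₁ s = s
    ... | inj₂ s = ⊥-elim (no-common-head (m + toℕ y) (toℕ y) back (R-resp _ (toℕ y) x≋ ≋-refl (toR t)))
      where
      back : R (m + toℕ y) (toℕ y)
      back = R-resp (m + toℕ y) (toℕ y) ≋-refl (full-turn (toℕ y)) (forward (m + toℕ y))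
      x≋ : toℕ x ≋ 2 + (m + toℕ y)
      x≋ = ≋-trans s (≋-+ˡ 1 (≋-sym (full-turn (toℕ y))))

-- The edge {0, 1} decides whether T runs forwards or, after reflection, backwards.
cycle-dichotomy : ∀ m → 3 ≤ m → ∀ {T} → LocallyInOver (CycleAdj (suc m)) T →
  Dichotomy (DCycleArc (suc m)) T
cycle-dichotomy m 3≤m {T} S = map forwards backwards (proj₂ underlying (proj₂ cycle⇔step (inj₁ step₀₁)))
  where
  open Modular m
  open CycleGeometry m
  open LocallyInOver S
  step₀₁ : Step 1 [ 0 ] [ 1 ]
  step₀₁ = step-[] {1} {0} ≋-refl
  forwards : T [ 0 ] [ 1 ] → T ⇔ DCycleArc N
  forwards t = ⇔-trans (DirectedCycle.directed-cycle m 3≤m S step₀₁ t) (⇔-sym dcycle⇔step)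
  backwards : T [ 1 ] [ 0 ] → Reflect T ⇔ DCycleArc N
  backwards t = ⇔-trans (DirectedCycle.directed-cycle m 3≤m (reflect-locallyIn cycle-reflect S)
                           (step-reflect {1} {[ 0 ]} {[ 1 ]} step₀₁) (proj₂ (reflect-involutive {T = T}) t))
                        (⇔-sym dcycle⇔step)

-- Part 2: a locally in-semicomplete orientation T of the complement of C_N, N ≥ 5,
-- containing one arc of length two, sends every even offset forwards and every odd one backwards.
module AlternatingOrientation (m : ℕ) (4≤m : 4 ≤ m) {T : Rel (suc m)}
  (S : LocallyInOver (CycleGeometry.NonAdj m) T)
  {x₀ y₀ : Fin (suc m)} (s₀ : CycleGeometry.Step m 2 x₀ y₀) (t₀ : T x₀ y₀) where
  open Modular m
  open CycleGeometry m
  open Positions m T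
  open LocallyInOver S

  5≤N : 5 ≤ N
  5≤N = s≤s 4≤m

  4≤N : 4 ≤ N
  4≤N = ≤-trans (n≤1+n 4) 5≤N

  joined : ∀ v d → 2 ≤ d → 2 + d ≤ N → R v (d + v) ⊎ R (d + v) v
  joined v d 2≤d d+2≤N = proj₂ underlying (far-apart 2≤d d+2≤N (step-[] {d} {v} ≋-refl))

  -- consecutive vertices are adjacent on the cycle, hence not joined in T,
  -- so they have no common out-neighbour
  no-common-head : ∀ a w → R a w → R (suc a) w → ⊥
  no-common-head a w r₁ r₂ = proj₂ (proj₁ underlying (in-local r₁ r₂ (step-distinct 1≤m consecutive)))
                                   (proj₂ cycle⇔step (inj₁ consecutive))
    where
    1≤m : 1 ≤ m
    1≤m = ≤-trans (s≤s z≤n) 4≤m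
    consecutive : Step 1 [ a ] [ suc a ]
    consecutive = step-[] {1} {a} ≋-refl

  -- an arc u + 1 → u + 3 forces u + 3 → u, and then u → u + 2
  two-step-down : ∀ u → R (suc u) (3 + u) → R u (2 + u)
  two-step-down u r with joined u 3 (s≤s (s≤s z≤n)) 5≤N
  ... | inj₁ r′ = ⊥-elim (no-common-head u (3 + u) r′ r)
  ... | inj₂ r′ with joined u 2 ≤-refl 4≤N
  ...   | inj₁ r″ = r″
  ...   | inj₂ r″ = ⊥-elim (no-common-head (2 + u) u r″ r′)

  two-step-from : ∀ t u → R (t + u) (2 + (t + u)) → R u (2 + u)
  two-step-from zero    u r = r
  two-step-from (suc t) u r = two-step-from t u (two-step-down (t + u) r)

  -- going backwards round the cycle from the given arc, every arc of length two is forwards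
  all-two-steps : ∀ v → R v (2 + v)
  all-two-steps v = two-step-from (v₀ + v * m) v
    (R-resp (v₀ + v * m + v) (2 + (v₀ + v * m + v)) (≋-sym (wind v₀ v)) (≋-+ˡ 2 (≋-sym (wind v₀ v)))
      (R-resp v₀ (2 + v₀) ≋-refl s₀ (toR t₀)))
    where v₀ = toℕ x₀

  EvenForward : ℕ → Set
  EvenForward j = ∀ v → R v (twice j + v)

  OddBackward : ℕ → Set
  OddBackward j = ∀ v → R (suc (twice j) + v) v

  -- v → v + 2j + 1 together with v + 1 → v + 2j + 1 is impossible
  even⇒odd : ∀ j → 1 ≤ j → 2 + suc (twice j) ≤ N → EvenForward j → OddBackward j
  even⇒odd (suc j) _ bound ev v with joined v (suc (twice (suc j))) (s≤s (s≤s z≤n)) bound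
  ... | inj₂ r = r
  ... | inj₁ r = ⊥-elim (no-common-head v (suc (twice (suc j)) + v) r
                   (R-resp (suc v) (suc (twice (suc j)) + v) ≋-refl (≡⇒≋ (+-suc (twice (suc j)) v)) (ev (suc v))))

  -- v + 2j + 2 → v together with v + 2j + 1 → v is impossible
  odd⇒even : ∀ j → 2 + twice (suc j) ≤ N → OddBackward j → EvenForward (suc j)
  odd⇒even j bound od v with joined v (twice (suc j)) (s≤s (s≤s z≤n)) bound
  ... | inj₁ r = r
  ... | inj₂ r = ⊥-elim (no-common-head (suc (twice j) + v) v (od v) r)

  even-forward : ∀ j → 2 + twice (suc j) ≤ N → EvenForward (suc j)
  even-forward zero    _     = all-two-steps
  even-forward (suc j) bound = odd⇒even (suc j) bound
    (even⇒odd (suc j) (s≤s z≤n) (≤-trans (n≤1+n _) bound)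
      (even-forward j (≤-trans (n≤1+n _) (≤-trans (n≤1+n _) bound))))

  no-odd-forward : ∀ j v → 1 ≤ j → 2 + suc (twice j) ≤ N → ¬ R v (suc (twice j) + v)
  no-odd-forward (suc i) v _ bound r = no-common-head v (suc (twice (suc i)) + v) r
    (R-resp (suc v) (suc (twice (suc i)) + v) ≋-refl (≡⇒≋ (+-suc (twice (suc i)) v))
      (even-forward i (≤-trans (n≤1+n _) bound) (suc v)))

  -- if N = 2K then 2 → 2K ≡ 0 and 3 → 0 would be arcs with consecutive tails
  N-odd : ∀ K → N ≢ twice K
  N-odd (suc (suc K)) N≡ = no-common-head 2 0 wrapped (even⇒odd 1 ≤-refl 5≤N all-two-steps 0)
    where
    wrapped : R 2 0
    wrapped = R-resp 2 0 ≋-refl (≋-trans (≡⇒≋ (trans (+-comm (twice (suc K)) 2) (sym N≡))) (+N-≋ 0))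
                (even-forward K (≤-reflexive (sym N≡)) 2)
  N-odd (suc zero) N≡ with subst (5 ≤_) N≡ 5≤N
  ... | s≤s (s≤s ())

  order : Σ ℕ λ k → 2 ≤ k × m ≡ 2 * k
  order with even-or-odd m
  ... | k , inj₂ m≡ = ⊥-elim (N-odd (suc k) (cong suc m≡))
  ... | zero , inj₁ m≡ with subst (4 ≤_) m≡ 4≤m
  ...   | ()
  order | suc zero , inj₁ m≡ with subst (4 ≤_) m≡ 4≤m
  ...   | s≤s (s≤s ())
  order | suc (suc k) , inj₁ m≡ = suc (suc k) , s≤s (s≤s z≤n) , trans m≡ (twice≡2* _)

  alternating : ∀ {k} → m ≡ 2 * k → T ⇔ EvenStep
  alternating {k} m≡ = to , from
    where
    N≡ : N ≡ suc (twice k)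
    N≡ = cong suc (trans m≡ (sym (twice≡2* k)))
    from : EvenStep ⇒ T
    from {x} {y} (suc j , _ , bound , s) =
      fromR (R-resp (toℕ x) (toℕ y) ≋-refl (≋-sym s) (even-forward j (≤-trans (n≤1+n _) bound) (toℕ x)))
    -- an arc joins far-apart vertices, and odd offsets are excluded
    to : T ⇒ EvenStep
    to {x} {y} t with far-offset (proj₁ underlying (inj₁ t))
    ... | d , 2≤d , bound , s with even-or-odd d
    ...   | suc j , inj₁ refl = suc j , s≤s z≤n , subst (3 + twice (suc j) ≤_) (sym N≡) gap , s
      where
      gap : 3 + twice (suc j) ≤ suc (twice k)
      gap = s≤s (even-gap (suc j) k (≤-pred (subst (2 + twice (suc j) ≤_) N≡ bound)))
    ...   | suc j , inj₂ refl = ⊥-elim (no-odd-forward (suc j) (toℕ x) (s≤s z≤n) bound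
                                  (R-resp (toℕ x) (suc (twice (suc j)) + toℕ x) ≋-refl s (toR t)))
    to t | _ , () , _ , _ | zero , inj₁ refl
    to t | _ , s≤s () , _ , _ | zero , inj₂ refl

-- The pair {0, 2} decides whether T or its reflection contains a forward arc of length two.
complement-dichotomy : ∀ m → 4 ≤ m → ∀ {T} → LocallyInOver (CycleGeometry.NonAdj m) T →
  Σ ℕ λ k → 2 ≤ k × m ≡ 2 * k × Dichotomy (CycleGeometry.EvenStep m) T
complement-dichotomy m 4≤m {T} S =
  either (λ t → conclude S step₀₂ t inj₁)
         (λ t → conclude (reflect-locallyIn nonadj-reflect S) (step-reflect {2} {[ 0 ]} {[ 2 ]} step₀₂)
                         (proj₂ (reflect-involutive {T = T}) t) inj₂)
    (proj₂ (LocallyInOver.underlying S) (far-apart ≤-refl (s≤s (≤-trans (n≤1+n 3) 4≤m)) step₀₂))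
  where
  open Modular m
  open CycleGeometry m
  step₀₂ : Step 2 [ 0 ] [ 2 ]
  step₀₂ = step-[] {2} {0} ≋-refl
  conclude : ∀ {T′} → LocallyInOver NonAdj T′ → ∀ {x y} → Step 2 x y → T′ x y →
             (T′ ⇔ EvenStep → Dichotomy EvenStep T) → Σ ℕ λ k → 2 ≤ k × m ≡ 2 * k × Dichotomy EvenStep T
  conclude S′ s t into with AlternatingOrientation.order m 4≤m S′ s t
  ... | k , 2≤k , m≡ = k , 2≤k , m≡ , into (AlternatingOrientation.alternating m 4≤m S′ s t {k} m≡)

-- On N = 2k + 1 vertices, "an even offset between 2 and N - 3" is exactly the arc
-- relation of C_{2k+1}(2, -3, 4, …): an even offset 2j > k is the odd offset N - 2j ≤ k backwards.
module AltCirculant (k : ℕ) (2≤k : 2 ≤ k) where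
  open Modular (2 * k)
  open CycleGeometry (2 * k)

  split-N : ∀ {j i} → j + i ≡ k → twice j + suc (twice i) ≡ N
  split-N {j} {i} j+i≡k = begin
    twice j + suc (twice i)  ≡⟨ +-suc (twice j) (twice i) ⟩
    suc (twice j + twice i)  ≡⟨ cong suc (twice-+ j i) ⟨
    suc (twice (j + i))      ≡⟨ cong (suc ∘ twice) j+i≡k ⟩
    suc (twice k)            ≡⟨ cong suc (twice≡2* k) ⟩
    N                        ∎
    where open ≡-Reasoning

  even→alt : EvenStep ⇒ AltCirculantArc k
  even→alt {x} {y} (suc j′ , _ , bound , s) with twice (suc j′) ≤? k
  ... | yes 2j≤k =
    twice (suc j′) , s≤s (s≤s z≤n) , 2j≤k , inj₁ (twice-%2 (suc j′) , step→mod {twice (suc j′)} {x} {y} s)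
  ... | no 2j≰k = backwards (m≤n⇒∃[o]m+o≡n (<⇒≤ j<k))
    where
    j : ℕ
    j = suc j′
    j<k : j < k
    j<k = twice-cancel-≤ (subst (twice (suc j) ≤_) (sym (twice≡2* k)) (≤-pred bound))
    backwards : Σ ℕ (λ i → j + i ≡ k) → AltCirculantArc k x y
    backwards (zero , j+0≡k) = ⊥-elim (<-irrefl (trans (sym (+-identityʳ j)) j+0≡k) j<k)
    backwards (suc i , j+i≡k) =
      e , s≤s (s≤s z≤n) , odd≤k , inj₂ (odd-%2 (suc i) , step→mod {e} {y} {x} backward)
      where
      e : ℕ
      e = suc (twice (suc i))
      backward : Step e y x
      backward = step-complement {twice j} {e} {x} {y} s (split-N {j} {suc i} j+i≡k)
      i<j : suc i < j
      i<j = +-cancelˡ-< j (suc i) j (subst₂ _<_ (sym j+i≡k) (twice≡+ j) (≰⇒> 2j≰k))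
      odd≤k : suc (twice (suc i)) ≤ k
      odd≤k = begin
        suc (twice (suc i))    ≡⟨ cong suc (twice≡+ (suc i)) ⟩
        suc (suc i + suc i)    ≤⟨ +-monoˡ-≤ (suc i) i<j ⟩
        j + suc i              ≡⟨ j+i≡k ⟩
        k                      ∎
        where open ≤-Reasoning

  short-even : ∀ {e x y} → Σ ℕ (λ j → e ≡ twice j) → 2 ≤ e → e ≤ k → Step e x y → EvenStep x y
  short-even (zero , refl) () _ _
  short-even (suc j , refl) _ e≤k s = suc j , s≤s z≤n , bound , s
    where
    bound : 3 + twice (suc j) ≤ N
    bound = s≤s (subst (2 + twice (suc j) ≤_) (trans (sym (twice≡+ k)) (twice≡2* k)) (+-mono-≤ 2≤k e≤k))

  -- an odd offset 2 ≤ e ≤ k backwards is the even offset N - e forwards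
  short-odd : ∀ {e x y} → Σ ℕ (λ i → e ≡ suc (twice i)) → 2 ≤ e → e ≤ k → Step e y x → EvenStep x y
  short-odd (zero , refl) (s≤s ()) _ _
  short-odd {e} {x} {y} (suc i′ , refl) _ e≤k s = forwards (m≤n⇒∃[o]m+o≡n i≤k)
    where
    i : ℕ
    i = suc i′
    i≤k : i ≤ k
    i≤k = ≤-trans (≤-twice i) (≤-trans (n≤1+n _) e≤k)
    forwards : Σ ℕ (λ j → i + j ≡ k) → EvenStep x y
    forwards (zero , i+0≡k) = ⊥-elim (<-irrefl refl (≤-trans (s≤s (≤-twice i)) odd≤i))
      where
      odd≤i : suc (twice i) ≤ i
      odd≤i = subst (suc (twice i) ≤_) (trans (sym i+0≡k) (+-identityʳ i)) e≤k
    forwards (suc j , i+j≡k) =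
      suc j , s≤s z≤n , bound , step-complement {e} {twice (suc j)} {y} {x} s (trans (+-comm e _) full)
      where
      full : twice (suc j) + e ≡ N
      full = split-N {suc j} {i} (trans (+-comm (suc j) i) i+j≡k)
      bound : 3 + twice (suc j) ≤ N
      bound = begin
        3 + twice (suc j)      ≡⟨ +-comm 3 (twice (suc j)) ⟩
        twice (suc j) + 3      ≤⟨ +-monoʳ-≤ (twice (suc j)) (s≤s (s≤s (s≤s z≤n))) ⟩
        twice (suc j) + e      ≡⟨ full ⟩
        N                      ∎
        where open ≤-Reasoning

  alt→even : AltCirculantArc k ⇒ EvenStep
  alt→even {x} {y} (e , 2≤e , e≤k , inj₁ (e%2≡0 , eq)) =
    short-even (%2≡0⇒even e e%2≡0) 2≤e e≤k (mod→step {e} {x} {y} eq)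
  alt→even {x} {y} (e , 2≤e , e≤k , inj₂ (e%2≡1 , eq)) =
    short-odd (%2≡1⇒odd e e%2≡1) 2≤e e≤k (mod→step {e} {y} {x} eq)

  even⇔alt : EvenStep ⇔ AltCirculantArc k
  even⇔alt = even→alt , alt→even

-- If σ maps the complement of G_D onto C_N, then under σ the underlying graph
-- of D is the complement of C_N (arcs are decidable and D has no loops).
complement-underlying : ∀ m (D : Digraph (suc m)) (σ : Permutation′ (suc m)) →
  Carries σ (AdjCompl D) (CycleAdj (suc m)) → Sym (Relabel σ (Arc D)) ⇔ CycleGeometry.NonAdj m
complement-underlying m D σ iso = to , from
  where
  compl : Relabel σ (AdjCompl D) ⇔ CycleAdj (suc m)
  compl = carries⇒relabel σ iso
  no-loop : ∀ u → ¬ Arc D u u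
  no-loop u a with trans (sym a) (loopless D u)
  ... | ()
  adjacent? : ∀ u v → Dec (AdjU D u v)
  adjacent? u v = (arc D u v ≟ᵇ true) ⊎-dec (arc D v u ≟ᵇ true)
  to : ∀ {x y} → Sym (Relabel σ (Arc D)) x y → CycleGeometry.NonAdj m x y
  to a = (λ { refl → no-loop _ (reduce a) }) , (λ c → proj₂ (proj₂ compl c) a)
  from : ∀ {x y} → CycleGeometry.NonAdj m x y → Sym (Relabel σ (Arc D)) x y
  from {x} {y} (x≢y , nc) with adjacent? (σ ⟨$⟩ˡ x) (σ ⟨$⟩ˡ y)
  ... | yes a = a
  ... | no ¬a = ⊥-elim (nc (proj₁ compl (x≢y ∘ inverse-injective σ , ¬a)))

underlying-cycle : ∀ m → 3 ≤ m → (D : Digraph (suc m)) →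
  LocallyInSemicomplete D ⊎ LocallyOutSemicomplete D → IsCycleGraph (suc m) (AdjU D) → IsDirectedCycle D
underlying-cycle m 3≤m D loc (σ , iso) with in-semicomplete-form D σ loc (carries⇒relabel σ iso)
... | T , S , back = dichotomy-carries σ (back (CycleGeometry.dcycle-reversal m) (cycle-dichotomy m 3≤m S))

complement-cycle : ∀ m → 4 ≤ m → (D : Digraph (suc m)) →
  LocallyInSemicomplete D ⊎ LocallyOutSemicomplete D → IsCycleGraph (suc m) (AdjCompl D) →
  Σ ℕ λ k → 2 ≤ k × IsoAltCirculant D k
complement-cycle m 4≤m D loc (σ , iso) with in-semicomplete-form D σ loc (complement-underlying m D σ iso)
... | T , S , back with complement-dichotomy m 4≤m S
...   | k , 2≤k , m≡2k , dichotomy =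
  k , 2≤k , as-circulant m≡2k D (dichotomy-carries σ (back (CycleGeometry.even-step-reversal m) dichotomy))
  where
  as-circulant : ∀ {m} → m ≡ 2 * k → (D : Digraph (suc m)) →
    Σ (Permutation′ (suc m)) (λ π → Carries π (Arc D) (CycleGeometry.EvenStep m)) → IsoAltCirculant D k
  as-circulant refl D (π , iso) =
    π , carries-⇔ {π = π} {A = Arc D} {P = CycleGeometry.EvenStep (2 * k)} iso (AltCirculant.even⇔alt k 2≤k)

lemma1 : ∀ {n} (D : Digraph n) →
    (LocallyInSemicomplete D ⊎ LocallyOutSemicomplete D) →
    ((4 ≤ n → IsCycleGraph n (AdjU D) → IsDirectedCycle D)
    × (5 ≤ n → IsCycleGraph n (AdjCompl D) → Σ ℕ λ k → 2 ≤ k × IsoAltCirculant D k))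
lemma1 {zero}  D loc = (λ ()) , (λ ())
lemma1 {suc m} D loc = (λ 4≤n → underlying-cycle m (≤-pred 4≤n) D loc)
                     , (λ 5≤n → complement-cycle m (≤-pred 5≤n) D loc)
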